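{- There is an absolute constant $K>0$ such that the following holds. Let $F$ be either $\mathbb{Q}$ or $\mathbb{Z}/m\mathbb{Z}$ for a positive integer $m$, let $M$ be an $F$-module, $C$ a finite subset of $M$ and $k_1,k_2$ positive integers. For any $A\subset C$ with $\operatorname{card}(A)=k_1$ and $\operatorname{card}(A\hat{+}A)\le k_2$, there exist $a^*\in A$ and subsets $A_0',A_1\subset A$ with $\operatorname{card}(A_0')+\operatorname{card}(A\setminus A_1)\le K(k_1k_2\log k_1)^{1/3}$ such that $a^*+A_1\subset A_0'\hat{+}A_0'$. Similarly, for any $A\subset C$ with $\operatorname{card}(A)=k_1$ and $\operatorname{card}(A-A)=k_2$, there exist $a^*\in A$ and subsets $A_0',A_1\subset A$ with $\operatorname{card}(A_0')+\operatorname{card}(A\setminus A_1)\le K(k_1k_2\log k_1)^{1/3}$ such that $a^*-A_1\subset A_0'-A_0'$.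
   Context: $X\hat{+}X=\{x+x':x,x'\in X,x\ne x'\}$, $X-X=\{x-x':x,x'\in X\}$, $a^*+Y=\{a^*+y:y\in Y\}$, $a^*-Y=\{a^*-y:y\in Y\}$. -}

module Defs where

open import Level using (Level; 0ℓ; Setω)
open import Data.Nat as ℕ using (ℕ; _≤_; _^_)
open import Data.Nat.Logarithm using (⌊log₂_⌋)
open import Data.Integer as ℤ using (ℤ; +_; _-_; _*_; -_)
open import Data.Integer.Properties as ℤP using ()
open import Data.Integer.Solver using (module +-*-Solver)
open import Data.Product using (Σ; _,_; ∃; _×_)
open import Data.List using (List; length)
open import Data.Fin using (Fin)
open import Data.Fin.Subset using (Subset; _∈_)
open import Relation.Binary.PropositionalEquality as Eq using (_≡_; refl; cong; cong₂; trans; sym)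
open import Relation.Binary.Core using (Rel)
open import Relation.Nullary using (¬_)
open import Algebra.Bundles using (CommutativeRing)
open import Algebra.Structures using (IsCommutativeRing)
open import Algebra.Module.Bundles using (Module)
import Data.Rational.Properties as ℚP
import Data.List.Membership.Setoid as SetoidMembership
import Data.List.Relation.Unary.Unique.Setoid as SetoidUnique

-- The ring ℤ/mℤ, realised as ℤ with equality "congruent modulo m".

module ZMod (m : ℕ) where

  infix 4 _≈_
  _≈_ : Rel ℤ 0ℓ
  x ≈ y = Σ ℤ λ k → x - y ≡ k * + m

  open +-*-Solver

  private
    M : ℤ
    M = + m

  ≡⇒≈ : ∀ {x y} → x ≡ y → x ≈ y
  ≡⇒≈ {x} refl = ℤ.0ℤ , trans (ℤP.+-inverseʳ x) (sym (ℤP.*-zeroˡ M))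

  ≈-sym : ∀ {x y} → x ≈ y → y ≈ x
  ≈-sym {x} {y} (k , e) = - k , trans
    (solve 2 (λ x y → y :- x := :- (x :- y)) refl x y)
    (trans (cong -_ e) (ℤP.neg-distribˡ-* k M))

  ≈-trans : ∀ {x y z} → x ≈ y → y ≈ z → x ≈ z
  ≈-trans {x} {y} {z} (k , e) (l , f) = k ℤ.+ l , trans
    (solve 3 (λ x y z → x :- z := (x :- y) :+ (y :- z)) refl x y z)
    (trans (cong₂ ℤ._+_ e f) (sym (ℤP.*-distribʳ-+ M k l)))

  +-cong : ∀ {x y u v} → x ≈ y → u ≈ v → x ℤ.+ u ≈ y ℤ.+ v
  +-cong {x} {y} {u} {v} (k , e) (l , f) = k ℤ.+ l , trans
    (solve 4 (λ x y u v → (x :+ u) :- (y :+ v) := (x :- y) :+ (u :- v)) refl x y u v)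
    (trans (cong₂ ℤ._+_ e f) (sym (ℤP.*-distribʳ-+ M k l)))

  neg-cong : ∀ {x y} → x ≈ y → - x ≈ - y
  neg-cong {x} {y} (k , e) = - k , trans
    (solve 2 (λ x y → (:- x) :- (:- y) := :- (x :- y)) refl x y)
    (trans (cong -_ e) (ℤP.neg-distribˡ-* k M))

  *-cong : ∀ {x y u v} → x ≈ y → u ≈ v → x * u ≈ y * v
  *-cong {x} {y} {u} {v} (k , e) (l , f) = x * l ℤ.+ k * v , trans
    (solve 4 (λ x y u v → (x :* u) :- (y :* v) := x :* (u :- v) :+ (x :- y) :* v) refl x y u v)
    (trans (cong₂ ℤ._+_ (cong (x *_) f) (cong (_* v) e))
      (solve 5 (λ x l k v M → x :* (l :* M) :+ (k :* M) :* v := (x :* l :+ k :* v) :* M) refl x l k v M))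

  isCommutativeRing : IsCommutativeRing _≈_ ℤ._+_ _*_ -_ ℤ.0ℤ ℤ.1ℤ
  isCommutativeRing = record
    { isRing = record
      { +-isAbelianGroup = record
        { isGroup = record
          { isMonoid = record
            { isSemigroup = record
              { isMagma = record
                { isEquivalence = record { refl = λ {x} → ≡⇒≈ {x} refl ; sym = λ {x} {y} → ≈-sym {x} {y} ; trans = λ {x} {y} {z} → ≈-trans {x} {y} {z} }
                ; ∙-cong = λ {x} {y} {u} {v} → +-cong {x} {y} {u} {v} }
              ; assoc = λ x y z → ≡⇒≈ (ℤP.+-assoc x y z) }
            ; identity = (λ x → ≡⇒≈ (ℤP.+-identityˡ x)) , (λ x → ≡⇒≈ (ℤP.+-identityʳ x)) }
          ; inverse = (λ x → ≡⇒≈ (ℤP.+-inverseˡ x)) , (λ x → ≡⇒≈ (ℤP.+-inverseʳ x))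
          ; ⁻¹-cong = λ {x} {y} → neg-cong {x} {y} }
        ; comm = λ x y → ≡⇒≈ (ℤP.+-comm x y) }
      ; *-cong = λ {x} {y} {u} {v} → *-cong {x} {y} {u} {v}
      ; *-assoc = λ x y z → ≡⇒≈ (ℤP.*-assoc x y z)
      ; *-identity = (λ x → ≡⇒≈ (ℤP.*-identityˡ x)) , (λ x → ≡⇒≈ (ℤP.*-identityʳ x))
      ; distrib = (λ x y z → ≡⇒≈ (ℤP.*-distribˡ-+ x y z)) , (λ x y z → ≡⇒≈ (ℤP.*-distribʳ-+ x y z)) }
    ; *-comm = λ x y → ≡⇒≈ (ℤP.*-comm x y) }

  commutativeRing : CommutativeRing 0ℓ 0ℓ
  commutativeRing = record { isCommutativeRing = isCommutativeRing }

ℤ/_ℤ : ℕ → CommutativeRing 0ℓ 0ℓ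
ℤ/ m ℤ = ZMod.commutativeRing m

data Coeff : Set where
  ℚ-coeff : Coeff
  ℤmod    : (m : ℕ) → 1 ≤ m → Coeff

ringOf : Coeff → CommutativeRing 0ℓ 0ℓ
ringOf ℚ-coeff     = ℚP.+-*-commutativeRing
ringOf (ℤmod m _)  = ℤ/ m ℤ

module InModule {r ℓr m ℓm : Level} {R : CommutativeRing r ℓr} (M : Module R m ℓm) where
  open Module M

  _-ᴹ_ : Carrierᴹ → Carrierᴹ → Carrierᴹ
  x -ᴹ y = x +ᴹ (-ᴹ y)

  open SetoidMembership ≈ᴹ-setoid public using () renaming (_∈_ to _∈ᴹ_)
  open SetoidUnique ≈ᴹ-setoid public using () renaming (Unique to Uniqueᴹ)

  record FinSubset (k : ℕ) : Set (m Level.⊔ ℓm) where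
    field
      elem : Fin k → Carrierᴹ
      inj  : ∀ i j → elem i ≈ᴹ elem j → i ≡ j
  open FinSubset public

  -- card(A +̂ A) ≤ k₂ : the set {a + a' : a, a' ∈ A, a ≠ a'} is covered by
  -- at most k₂ elements.
  CardRestrSumLe : ∀ {k} → FinSubset k → ℕ → Set (m Level.⊔ ℓm)
  CardRestrSumLe {k} A k₂ = Σ (List Carrierᴹ) λ L → length L ≤ k₂ ×
    (∀ (i j : Fin k) → ¬ (i ≡ j) → (elem A i +ᴹ elem A j) ∈ᴹ L)

  -- card(A − A) = k₂ : the set {a − a' : a, a' ∈ A} is enumerated by a
  -- duplicate-free list of length k₂.
  CardDiffEq : ∀ {k} → FinSubset k → ℕ → Set (m Level.⊔ ℓm)
  CardDiffEq {k} A k₂ = Σ (List Carrierᴹ) λ L → Uniqueᴹ L × length L ≡ k₂ ×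
    (∀ (i j : Fin k) → (elem A i -ᴹ elem A j) ∈ᴹ L) ×
    (∀ y → y ∈ᴹ L → Σ (Fin k) λ i → Σ (Fin k) λ j → y ≈ᴹ (elem A i -ᴹ elem A j))

  _⊆ᴸ_ : ∀ {k} → FinSubset k → List Carrierᴹ → Set (m Level.⊔ ℓm)
  _⊆ᴸ_ {k} A C = ∀ (i : Fin k) → elem A i ∈ᴹ C

-- "There is a constant K > 0 (a natural number, K ≥ 1) such that P K",
-- where P K is Setω (it quantifies over modules of all universe levels).

record ∃PosConst (P : ℕ → Setω) : Setω where
  constructor _,_,_
  field
    const : ℕ
    pos   : 1 ≤ const
    holds : P const

-- The bound  c ≤ K (k₁ k₂ log k₁)^{1/3},  written without reals as
-- c³ ≤ K³ · k₁ · k₂ · ⌊log₂ k₁⌋.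
WithinBound : (K k₁ k₂ c : ℕ) → Set
WithinBound K k₁ k₂ c = c ^ 3 ≤ K ^ 3 ℕ.* (k₁ ℕ.* k₂ ℕ.* ⌊log₂ k₁ ⌋)

module Submission where

-- Both parts reduce to one statement about a labelling κ of Fin n × Fin n by
-- labels ≤ s, injective in rows and columns on non-zero labels: κ j l is one
-- plus the position of aⱼ + aₗ (j ≠ l; 0 if j = l), resp. of aⱼ − aₗ, in a
-- list enumerating A +̂ A, resp. A − A.  Put c ≈ (8 n s log₂ n)^(1/3) and call
-- a label popular if it occurs R ≈ (n/c)² log₂ n times.  At most s R cells carry
-- unpopular labels, so some row a* has at most s R / n ≤ c of them; A₁ is the
-- set of popular cells of that row.  Two independent random sets X, Y, each
-- containing every element with probability c/n, meet each popular label in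
-- X × Y except with probability (1 − c²/n²)ᴿ ≤ 1/(4n), and |X| + |Y| < 4c except
-- with probability 1/2; so some X, Y do both and A₀′ = X ∪ Y costs at most 5c.
-- Probabilities are exact counts over the space of vectors Vec (Fin n) n.

open import Defs hiding (_,_,_)
open import Level using (Level)
open import Data.Nat using (ℕ; _≤_; _+_; _*_; _^_; s≤s; z≤n)
open import Data.Fin using (Fin)
open import Data.Fin.Subset using (Subset; _∈_; ∁; ∣_∣)
open import Data.List using (List)
open import Data.Product using (Σ; _×_; _,_)
open import Relation.Binary.PropositionalEquality using (_≡_; refl)
open import Relation.Nullary using (¬_)
open import Algebra.Bundles using (CommutativeRing)
open import Algebra.Module.Bundles using (Module)

module BooleanTests where

  open import Data.Nat using (_≡ᵇ_)
  open import Data.Nat.Properties using (≡ᵇ⇒≡)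
  open import Data.Bool using (Bool; true; false; not; _∧_; _∨_; T)
  open import Data.Bool.Properties using (T-≡)
  open import Data.Product using (_×_; _,_)
  open import Function.Bundles using (Equivalence)
  open import Relation.Binary.PropositionalEquality using (_≡_; refl)
  open import Relation.Nullary using (¬_)

  true≢false : ¬ true ≡ false
  true≢false ()

  T⇒≡true : ∀ {b} → T b → b ≡ true
  T⇒≡true = Equivalence.to T-≡

  ≡true⇒T : ∀ {b} → b ≡ true → T b
  ≡true⇒T = Equivalence.from T-≡

  ≡ᵇ-sound : ∀ m n → (m ≡ᵇ n) ≡ true → m ≡ n
  ≡ᵇ-sound m n e = ≡ᵇ⇒≡ m n (≡true⇒T e)

  ∧-elim : ∀ {x y} → x ∧ y ≡ true → x ≡ true × y ≡ true
  ∧-elim {true} {true} _ = refl , refl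

  ∧-intro : ∀ {x y} → x ≡ true → y ≡ true → x ∧ y ≡ true
  ∧-intro refl refl = refl

  ∨-introˡ : ∀ {x} y → x ≡ true → x ∨ y ≡ true
  ∨-introˡ y refl = refl

  ∨-introʳ : ∀ x {y} → y ≡ true → x ∨ y ≡ true
  ∨-introʳ true _ = refl
  ∨-introʳ false e = e

  not-true : ∀ {x} → not x ≡ true → x ≡ false
  not-true {false} _ = refl

  not-false : ∀ {x} → not x ≡ false → x ≡ true
  not-false {true} _ = refl

module FiniteSums where

  open import Data.Nat
  open import Data.Nat.Properties
  open import Data.Bool using (Bool; true; false; not; _∧_; _∨_; if_then_else_)
  open import Data.Bool.Properties using (∧-distribʳ-∨)
  open import Data.Fin using (Fin; zero; suc; toℕ)
  open import Data.Product using (Σ; _,_)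
  open import Function using (_∘_)
  import Data.Fin.Properties as FinP
  open import Relation.Nullary using (¬_; yes; no)
  open import Relation.Binary.PropositionalEquality
  open import Data.Nat.Solver using (module +-*-Solver)
  open +-*-Solver using (solve; _:+_; _:*_; _:=_; con)
  open ≤-Reasoning

  χ : Bool → ℕ
  χ true = 1
  χ false = 0

  ∑ : ∀ {n} → (Fin n → ℕ) → ℕ
  ∑ {zero} f = 0
  ∑ {suc n} f = f zero + ∑ (f ∘ suc)

  ∏ : ∀ {n} → (Fin n → ℕ) → ℕ
  ∏ {zero} f = 1
  ∏ {suc n} f = f zero * ∏ (f ∘ suc)

  count : ∀ {n} → (Fin n → Bool) → ℕ
  count p = ∑ (χ ∘ p)

  anyᶠ : ∀ {n} → (Fin n → Bool) → Bool
  anyᶠ {zero} p = false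
  anyᶠ {suc n} p = p zero ∨ anyᶠ (p ∘ suc)

  ∑-cong : ∀ {n} {f g : Fin n → ℕ} → (∀ i → f i ≡ g i) → ∑ f ≡ ∑ g
  ∑-cong {zero} e = refl
  ∑-cong {suc n} e = cong₂ _+_ (e zero) (∑-cong (e ∘ suc))

  ∏-cong : ∀ {n} {f g : Fin n → ℕ} → (∀ i → f i ≡ g i) → ∏ f ≡ ∏ g
  ∏-cong {zero} e = refl
  ∏-cong {suc n} e = cong₂ _*_ (e zero) (∏-cong (e ∘ suc))

  ∑-mono : ∀ {n} {f g : Fin n → ℕ} → (∀ i → f i ≤ g i) → ∑ f ≤ ∑ g
  ∑-mono {zero} e = z≤n
  ∑-mono {suc n} e = +-mono-≤ (e zero) (∑-mono (e ∘ suc))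

  ∑-+ : ∀ {n} (f g : Fin n → ℕ) → ∑ (λ i → f i + g i) ≡ ∑ f + ∑ g
  ∑-+ {zero} f g = refl
  ∑-+ {suc n} f g rewrite ∑-+ (f ∘ suc) (g ∘ suc) =
    solve 4 (λ a b c d → (a :+ b) :+ (c :+ d) := (a :+ c) :+ (b :+ d)) refl (f zero) (g zero) _ _

  ∑-*ˡ : ∀ {n} (c : ℕ) (f : Fin n → ℕ) → ∑ (λ i → c * f i) ≡ c * ∑ f
  ∑-*ˡ {zero} c f = sym (*-zeroʳ c)
  ∑-*ˡ {suc n} c f rewrite ∑-*ˡ c (f ∘ suc) = sym (*-distribˡ-+ c (f zero) _)

  ∑-const : ∀ {n} (c : ℕ) → ∑ {n} (λ _ → c) ≡ n * c
  ∑-const {zero} c = refl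
  ∑-const {suc n} c = cong (c +_) (∑-const {n} c)

  ∑-swap : ∀ {m n} (f : Fin m → Fin n → ℕ) → ∑ (λ i → ∑ (f i)) ≡ ∑ (λ j → ∑ (λ i → f i j))
  ∑-swap {zero} {n} f = sym (trans (∑-const {n} 0) (*-zeroʳ n))
  ∑-swap {suc m} f =
    trans (cong (∑ (f zero) +_) (∑-swap (f ∘ suc))) (sym (∑-+ (f zero) (λ j → ∑ (λ i → f (suc i) j))))

  ∑≡0⇒≡0 : ∀ {n} (f : Fin n → ℕ) → ∑ f ≡ 0 → ∀ i → f i ≡ 0
  ∑≡0⇒≡0 f e zero = m+n≡0⇒m≡0 _ e
  ∑≡0⇒≡0 f e (suc i) = ∑≡0⇒≡0 (f ∘ suc) (m+n≡0⇒n≡0 (f zero) e) i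

  ∑<∑⇒∃< : ∀ {n} (f g : Fin n → ℕ) → ∑ f < ∑ g → Σ (Fin n) λ i → f i < g i
  ∑<∑⇒∃< {zero} f g ()
  ∑<∑⇒∃< {suc n} f g lt with f zero <? g zero
  ... | yes p = zero , p
  ... | no ¬p with ∑<∑⇒∃< (f ∘ suc) (g ∘ suc)
                      (+-cancelˡ-< (g zero) _ _ (≤-<-trans (+-monoˡ-≤ _ (≮⇒≥ ¬p)) lt))
  ... | i , q = suc i , q

  ∃≤mean : ∀ {n} → 1 ≤ n → (f : Fin n → ℕ) → Σ (Fin n) λ x → n * f x ≤ ∑ f
  ∃≤mean {suc n} _ f with FinP.¬∀⟶∃¬ (suc n) (λ x → ∑ f < suc n * f x) (λ x → ∑ f <? suc n * f x) notAllAbove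
    where
    notAllAbove : ¬ (∀ x → ∑ f < suc n * f x)
    notAllAbove above = <-irrefl refl (begin-strict
      suc n * ∑ f                ≡⟨ sym (∑-const {suc n} (∑ f)) ⟩
      ∑ {suc n} (λ _ → ∑ f)       <⟨ +-mono-<-≤ (above zero) (∑-mono (<⇒≤ ∘ above ∘ suc)) ⟩
      ∑ (λ x → suc n * f x)       ≡⟨ ∑-*ˡ (suc n) f ⟩
      suc n * ∑ f                ∎)
  ... | x , ¬above = x , ≮⇒≥ ¬above

  ∏-ones : ∀ {n} (f : Fin n → ℕ) → (∀ i → f i ≡ 1) → ∏ f ≡ 1
  ∏-ones {zero} f e = refl
  ∏-ones {suc n} f e rewrite e zero | ∏-ones (f ∘ suc) (e ∘ suc) = refl

  anyᶠ-intro : ∀ {n} (p : Fin n → Bool) i → p i ≡ true → anyᶠ p ≡ true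
  anyᶠ-intro p zero e rewrite e = refl
  anyᶠ-intro p (suc i) e with p zero
  ... | true = refl
  ... | false = anyᶠ-intro (p ∘ suc) i e

  anyᶠ-elim : ∀ {n} (p : Fin n → Bool) → anyᶠ p ≡ true → Σ (Fin n) λ i → p i ≡ true
  anyᶠ-elim {zero} p ()
  anyᶠ-elim {suc n} p e with p zero in eq
  ... | true = zero , eq
  ... | false with anyᶠ-elim (p ∘ suc) e
  ... | i , q = suc i , q

  anyᶠ-∧ʳ : ∀ {n} (p : Fin n → Bool) c → anyᶠ (λ l → p l ∧ c) ≡ anyᶠ p ∧ c
  anyᶠ-∧ʳ {zero} p c = refl
  anyᶠ-∧ʳ {suc n} p c rewrite anyᶠ-∧ʳ (p ∘ suc) c = sym (∧-distribʳ-∨ c (p zero) (anyᶠ (p ∘ suc)))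

  count-none : ∀ {n} (p : Fin n → Bool) → (∀ i → p i ≡ false) → count p ≡ 0
  count-none {zero} p h = refl
  count-none {suc n} p h rewrite h zero = count-none (p ∘ suc) (h ∘ suc)

  unique⇒false-elsewhere : ∀ {n} (p : Fin (suc n) → Bool) → (∀ x y → p x ≡ true → p y ≡ true → x ≡ y) →
    p zero ≡ true → ∀ i → p (suc i) ≡ false
  unique⇒false-elsewhere p unique p0 i with p (suc i) in pi
  ... | true with unique zero (suc i) p0 pi
  ... | ()
  unique⇒false-elsewhere p unique p0 i | false = refl

  count≤1 : ∀ {n} (p : Fin n → Bool) → (∀ x y → p x ≡ true → p y ≡ true → x ≡ y) → count p ≤ 1
  count≤1 {zero} p unique = z≤n
  count≤1 {suc n} p unique with p zero in p0
  ... | true rewrite count-none (p ∘ suc) (unique⇒false-elsewhere p unique p0) = s≤s z≤n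
  ... | false = count≤1 (p ∘ suc) (λ x y px py → FinP.suc-injective (unique (suc x) (suc y) px py))

  χ-anyᶠ : ∀ {n} (p : Fin n → Bool) → count p ≤ 1 → χ (anyᶠ p) ≡ count p
  χ-anyᶠ {zero} p h = refl
  χ-anyᶠ {suc n} p h with p zero
  ... | true = sym (cong suc (n≤0⇒n≡0 (≤-pred h)))
  ... | false = χ-anyᶠ (p ∘ suc) h

  count-compl : ∀ {n} (p : Fin n → Bool) → count p + count (not ∘ p) ≡ n
  count-compl {zero} p = refl
  count-compl {suc n} p with p zero
  ... | true = cong suc (count-compl (p ∘ suc))
  ... | false = trans (+-suc _ _) (cong suc (count-compl (p ∘ suc)))

  count-∨ : ∀ {n} (p q : Fin n → Bool) → count (λ i → p i ∨ q i) ≤ count p + count q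
  count-∨ p q = ≤-trans (∑-mono (λ i → χ-∨ (p i) (q i))) (≤-reflexive (∑-+ (χ ∘ p) (χ ∘ q)))
    where
    χ-∨ : ∀ x y → χ (x ∨ y) ≤ χ x + χ y
    χ-∨ true y = s≤s z≤n
    χ-∨ false y = ≤-refl

  ∏-if : ∀ {n} (p : Fin n → Bool) u v → ∏ (λ x → if p x then u else v) ≡ u ^ count p * v ^ count (not ∘ p)
  ∏-if {zero} p u v = refl
  ∏-if {suc n} p u v with p zero
  ... | true rewrite ∏-if (p ∘ suc) u v = sym (*-assoc u _ _)
  ... | false rewrite ∏-if (p ∘ suc) u v =
    solve 3 (λ v x y → v :* (x :* y) := x :* (v :* y)) refl v (u ^ count (p ∘ suc)) (v ^ count (not ∘ p ∘ suc))

  ∏-if-count : ∀ {n} (p q : Fin n → Bool) u v → count p ≡ count q →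
    ∏ (λ x → if p x then u else v) ≡ ∏ (λ x → if q x then u else v)
  ∏-if-count {n} p q u v e rewrite ∏-if p u v | ∏-if q u v | e =
    cong (λ t → u ^ count q * v ^ t)
      (+-cancelˡ-≡ (count q) _ _ (trans (subst (λ t → t + count (not ∘ p) ≡ n) e (count-compl p)) (sym (count-compl q))))

  ∑-if : ∀ {n} (p : Fin n → Bool) u v → ∑ (λ x → if p x then u else v) ≡ u * count p + v * count (not ∘ p)
  ∑-if {zero} p u v = solve 2 (λ u v → con 0 := u :* con 0 :+ v :* con 0) refl u v
  ∑-if {suc n} p u v with p zero
  ... | true rewrite ∑-if (p ∘ suc) u v =
    solve 4 (λ u v x y → u :+ (u :* x :+ v :* y) := u :* (con 1 :+ x) :+ v :* y) refl u v (count (p ∘ suc)) (count (not ∘ p ∘ suc))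
  ... | false rewrite ∑-if (p ∘ suc) u v =
    solve 4 (λ u v x y → v :+ (u :* x :+ v :* y) := u :* x :+ v :* (con 1 :+ y)) refl u v (count (p ∘ suc)) (count (not ∘ p ∘ suc))

  count-< : ∀ b a → a ≤ b → count {b} (λ x → toℕ x <ᵇ a) ≡ a
  count-< zero .zero z≤n = refl
  count-< (suc b) zero _ = count-none {suc b} (λ x → toℕ x <ᵇ 0) (λ _ → refl)
  count-< (suc b) (suc a) (s≤s a≤b) = cong suc (count-< b a a≤b)

  ∑-sift : ∀ S (φ : ℕ → ℕ) v → v ≤ S → ∑ {suc S} (λ k → φ (toℕ k) * χ (v ≡ᵇ toℕ k)) ≡ φ v
  ∑-sift S φ zero _ = begin-equality
    φ 0 * 1 + ∑ {S} (λ k → φ (suc (toℕ k)) * 0)  ≡⟨ cong₂ _+_ (*-identityʳ (φ 0)) (∑-cong {S} (λ k → *-zeroʳ (φ (suc (toℕ k))))) ⟩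
    φ 0 + ∑ {S} (λ _ → 0)                        ≡⟨ cong (φ 0 +_) (trans (∑-const {S} 0) (*-zeroʳ S)) ⟩
    φ 0 + 0                                      ≡⟨ +-identityʳ _ ⟩
    φ 0                                          ∎
  ∑-sift (suc S) φ (suc v) (s≤s v≤S) =
    trans (cong (_+ ∑ {suc S} (λ k → φ (suc (toℕ k)) * χ (v ≡ᵇ toℕ k))) (*-zeroʳ (φ 0))) (∑-sift S (φ ∘ suc) v v≤S)

  ∑-fibres : ∀ {m} S (φ : ℕ → ℕ) (h : Fin m → ℕ) → (∀ x → h x ≤ S) →
    ∑ (λ x → φ (h x)) ≡ ∑ {suc S} (λ k → φ (toℕ k) * count (λ x → h x ≡ᵇ toℕ k))
  ∑-fibres {m} S φ h h≤S = begin-equality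
    ∑ (λ x → φ (h x))
      ≡⟨ ∑-cong {m} (λ x → sym (∑-sift S φ (h x) (h≤S x))) ⟩
    ∑ (λ x → ∑ {suc S} (λ k → φ (toℕ k) * χ (h x ≡ᵇ toℕ k)))
      ≡⟨ ∑-swap {m} {suc S} (λ x k → φ (toℕ k) * χ (h x ≡ᵇ toℕ k)) ⟩
    ∑ {suc S} (λ k → ∑ (λ x → φ (toℕ k) * χ (h x ≡ᵇ toℕ k)))
      ≡⟨ ∑-cong {suc S} (λ k → ∑-*ˡ (φ (toℕ k)) (λ x → χ (h x ≡ᵇ toℕ k))) ⟩
    ∑ {suc S} (λ k → φ (toℕ k) * count (λ x → h x ≡ᵇ toℕ k)) ∎

-- Counting
-- over this space is the exact form of the probabilistic argument below: a
-- uniform f ∈ Vec (Fin b) n chooses each coordinate independently.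
module SumsOverVectors where

  open import Data.Nat
  open import Data.Nat.Properties
  open import Data.Fin using (Fin; zero; suc; toℕ)
  open import Data.Vec using (Vec; []; _∷_; lookup)
  open import Data.Product using (Σ; _,_)
  open import Function using (_∘_)
  open import Relation.Binary.PropositionalEquality
  open import Data.Nat.Solver using (module +-*-Solver)
  open +-*-Solver using (solve; _:*_; _:=_)
  open FiniteSums

  ∑ᵛ : ∀ b n → (Vec (Fin b) n → ℕ) → ℕ
  ∑ᵛ b zero φ = φ []
  ∑ᵛ b (suc n) φ = ∑ (λ x → ∑ᵛ b n (λ v → φ (x ∷ v)))

  ∑ᵛ-cong : ∀ b n {φ ψ : Vec (Fin b) n → ℕ} → (∀ v → φ v ≡ ψ v) → ∑ᵛ b n φ ≡ ∑ᵛ b n ψ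
  ∑ᵛ-cong b zero e = e []
  ∑ᵛ-cong b (suc n) e = ∑-cong {b} (λ x → ∑ᵛ-cong b n (λ v → e (x ∷ v)))

  ∑ᵛ-mono : ∀ b n {φ ψ : Vec (Fin b) n → ℕ} → (∀ v → φ v ≤ ψ v) → ∑ᵛ b n φ ≤ ∑ᵛ b n ψ
  ∑ᵛ-mono b zero e = e []
  ∑ᵛ-mono b (suc n) e = ∑-mono {b} (λ x → ∑ᵛ-mono b n (λ v → e (x ∷ v)))

  ∑ᵛ-+ : ∀ b n (φ ψ : Vec (Fin b) n → ℕ) → ∑ᵛ b n (λ v → φ v + ψ v) ≡ ∑ᵛ b n φ + ∑ᵛ b n ψ
  ∑ᵛ-+ b zero φ ψ = refl
  ∑ᵛ-+ b (suc n) φ ψ = trans (∑-cong {b} (λ x → ∑ᵛ-+ b n (λ v → φ (x ∷ v)) (λ v → ψ (x ∷ v))))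
    (∑-+ {b} (λ x → ∑ᵛ b n (λ v → φ (x ∷ v))) (λ x → ∑ᵛ b n (λ v → ψ (x ∷ v))))

  ∑ᵛ-*ˡ : ∀ b n c (φ : Vec (Fin b) n → ℕ) → ∑ᵛ b n (λ v → c * φ v) ≡ c * ∑ᵛ b n φ
  ∑ᵛ-*ˡ b zero c φ = refl
  ∑ᵛ-*ˡ b (suc n) c φ = trans (∑-cong {b} (λ x → ∑ᵛ-*ˡ b n c (λ v → φ (x ∷ v)))) (∑-*ˡ {b} c (λ x → ∑ᵛ b n (λ v → φ (x ∷ v))))

  ∑ᵛ-const : ∀ b n c → ∑ᵛ b n (λ _ → c) ≡ b ^ n * c
  ∑ᵛ-const b zero c = sym (+-identityʳ c)
  ∑ᵛ-const b (suc n) c = trans (∑-cong {b} (λ x → ∑ᵛ-const b n c)) (trans (∑-const {b} (b ^ n * c)) (sym (*-assoc b _ c)))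

  ∑ᵛ-∑ : ∀ b n {m} (φ : Fin m → Vec (Fin b) n → ℕ) → ∑ᵛ b n (λ v → ∑ (λ i → φ i v)) ≡ ∑ (λ i → ∑ᵛ b n (φ i))
  ∑ᵛ-∑ b zero φ = refl
  ∑ᵛ-∑ b (suc n) {m} φ = trans (∑-cong {b} (λ x → ∑ᵛ-∑ b n (λ i v → φ i (x ∷ v))))
    (∑-swap {b} {m} (λ x i → ∑ᵛ b n (λ v → φ i (x ∷ v))))

  ∑ᵛ<∑ᵛ⇒∃< : ∀ b n (φ ψ : Vec (Fin b) n → ℕ) → ∑ᵛ b n φ < ∑ᵛ b n ψ → Σ (Vec (Fin b) n) λ v → φ v < ψ v
  ∑ᵛ<∑ᵛ⇒∃< b zero φ ψ lt = [] , lt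
  ∑ᵛ<∑ᵛ⇒∃< b (suc n) φ ψ lt with ∑<∑⇒∃< {b} (λ x → ∑ᵛ b n (λ v → φ (x ∷ v))) (λ x → ∑ᵛ b n (λ v → ψ (x ∷ v))) lt
  ... | x , lt′ with ∑ᵛ<∑ᵛ⇒∃< b n (λ v → φ (x ∷ v)) (λ v → ψ (x ∷ v)) lt′
  ... | v , q = x ∷ v , q

  ∑ᵛ-∏ : ∀ b n (φ : Fin n → Fin b → ℕ) → ∑ᵛ b n (λ v → ∏ (λ k → φ k (lookup v k))) ≡ ∏ (λ k → ∑ (φ k))
  ∑ᵛ-∏ b zero φ = refl
  ∑ᵛ-∏ b (suc n) φ =
    trans (∑-cong {b} (λ x → trans (∑ᵛ-*ˡ b n (φ zero x) (λ v → ∏ (λ k → φ (suc k) (lookup v k))))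
                              (trans (cong (φ zero x *_) (∑ᵛ-∏ b n (φ ∘ suc))) (*-comm (φ zero x) P))))
    (trans (∑-*ˡ {b} P (φ zero)) (*-comm P (∑ (φ zero))))
    where P = ∏ (λ k → ∑ (φ (suc k)))

  ∑ᵛ-coordinate< : ∀ b n a → a ≤ b → (k : Fin n) → b * ∑ᵛ b n (λ v → χ (toℕ (lookup v k) <ᵇ a)) ≡ a * b ^ n
  ∑ᵛ-coordinate< b (suc n) a a≤b k = trans (cong (b *_) (below k)) (swap₃ b a (b ^ n))
    where
    swap₃ : ∀ x y z → x * (y * z) ≡ y * (x * z)
    swap₃ = solve 3 (λ x y z → x :* (y :* z) := y :* (x :* z)) refl
    below : ∀ {n} (k : Fin (suc n)) → ∑ᵛ b (suc n) (λ v → χ (toℕ (lookup v k) <ᵇ a)) ≡ a * b ^ n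
    below {n} zero = trans (∑-cong {b} (λ x → ∑ᵛ-const b n _))
      (trans (∑-*ˡ {b} (b ^ n) (λ x → χ (toℕ x <ᵇ a))) (trans (*-comm (b ^ n) _) (cong (_* b ^ n) (count-< b a a≤b))))
    below {suc n} (suc k) = trans (∑-cong {b} (λ x → below k)) (trans (∑-const {b} _) (swap₃ b a (b ^ n)))

module Arithmetic where

  open import Data.Nat
  open import Data.Nat.Properties
  open import Data.Nat.Logarithm
  open import Data.Product using (Σ; _,_; _×_)
  open import Relation.Nullary using (yes; no)
  open import Relation.Binary.PropositionalEquality
  open import Data.Nat.Solver using (module +-*-Solver)
  open +-*-Solver
  open ≤-Reasoning

  1≤m^n : ∀ m n → 1 ≤ m → 1 ≤ m ^ n
  1≤m^n m zero _ = ≤-refl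
  1≤m^n m (suc n) p = *-mono-≤ p (1≤m^n m n p)

  ^-distribʳ-* : ∀ x y k → (x * y) ^ k ≡ x ^ k * y ^ k
  ^-distribʳ-* x y zero = refl
  ^-distribʳ-* x y (suc k) rewrite ^-distribʳ-* x y k =
    solve 4 (λ x y a b → x :* y :* (a :* b) := x :* a :* (y :* b)) refl x y (x ^ k) (y ^ k)

  -- Bernoulli's inequality (1 + A/B)^k ≥ 1 + kA/B, cleared of denominators.
  bernoulli : ∀ A B k → B ^ k * (B + k * A) ≤ (B + A) ^ k * B
  bernoulli A B zero = ≤-reflexive (solve 1 (λ B → con 1 :* (B :+ con 0) := con 1 :* B) refl B)
  bernoulli A B (suc k) = begin
    B * B ^ k * (B + suc k * A)
      ≡⟨ solve 4 (λ B p k A → B :* p :* (B :+ (con 1 :+ k) :* A) := p :* (B :* (B :+ k :* A) :+ A :* B)) refl B (B ^ k) k A ⟩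
    B ^ k * (B * (B + k * A) + A * B)
      ≤⟨ *-monoʳ-≤ (B ^ k) (+-monoʳ-≤ (B * (B + k * A)) (*-monoʳ-≤ A (m≤m+n B (k * A)))) ⟩
    B ^ k * (B * (B + k * A) + A * (B + k * A))
      ≡⟨ solve 4 (λ B p k A → p :* (B :* (B :+ k :* A) :+ A :* (B :+ k :* A)) := (B :+ A) :* (p :* (B :+ k :* A))) refl B (B ^ k) k A ⟩
    (B + A) * (B ^ k * (B + k * A))
      ≤⟨ *-monoʳ-≤ (B + A) (bernoulli A B k) ⟩
    (B + A) * ((B + A) ^ k * B)
      ≡⟨ sym (*-assoc (B + A) _ B) ⟩
    (B + A) * (B + A) ^ k * B ∎

  doubling : ∀ A B k → B ≤ k * A → 1 ≤ B → 2 * B ^ k ≤ (B + A) ^ k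
  doubling A B k kA≥B B≥1 = *-cancelʳ-≤ _ _ B {{>-nonZero B≥1}} (begin
    2 * B ^ k * B      ≡⟨ solve 2 (λ p B → con 2 :* p :* B := p :* (B :+ B)) refl (B ^ k) B ⟩
    B ^ k * (B + B)     ≤⟨ *-monoʳ-≤ (B ^ k) (+-monoʳ-≤ B kA≥B) ⟩
    B ^ k * (B + k * A) ≤⟨ bernoulli A B k ⟩
    (B + A) ^ k * B     ∎)

  -- (1 − A/B)^k ≤ 1/2 once kA ≥ B, using (1 − A/B)(1 + A/B) ≤ 1.
  halving : ∀ U A B k → U + A ≡ B → B ≤ k * A → 1 ≤ B → 2 * U ^ k ≤ B ^ k
  halving U A B k U+A≡B kA≥B B≥1 = *-cancelˡ-≤ (B ^ k) {{>-nonZero (1≤m^n B k B≥1)}} (begin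
    B ^ k * (2 * U ^ k)  ≡⟨ solve 2 (λ p q → p :* (con 2 :* q) := con 2 :* p :* q) refl (B ^ k) (U ^ k) ⟩
    2 * B ^ k * U ^ k    ≤⟨ *-monoˡ-≤ (U ^ k) (doubling A B k kA≥B B≥1) ⟩
    (B + A) ^ k * U ^ k  ≡⟨ sym (^-distribʳ-* (B + A) U k) ⟩
    ((B + A) * U) ^ k    ≤⟨ ^-monoˡ-≤ k product≤ ⟩
    (B * B) ^ k          ≡⟨ ^-distribʳ-* B B k ⟩
    B ^ k * B ^ k        ∎)
    where
    product≤ : (B + A) * U ≤ B * B
    product≤ = begin
      (B + A) * U          ≤⟨ m≤m+n _ (A * A) ⟩
      (B + A) * U + A * A  ≡⟨ solve 3 (λ B A U → (B :+ A) :* U :+ A :* A := B :* U :+ A :* (U :+ A)) refl B A U ⟩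
      B * U + A * (U + A)  ≡⟨ cong (λ t → B * U + A * t) U+A≡B ⟩
      B * U + A * B        ≡⟨ solve 3 (λ B A U → B :* U :+ A :* B := B :* (U :+ A)) refl B A U ⟩
      B * (U + A)          ≡⟨ cong (B *_) U+A≡B ⟩
      B * B                ∎

  halving-iterate : ∀ U B k e → 2 * U ^ k ≤ B ^ k → 2 ^ e * U ^ (e * k) ≤ B ^ (e * k)
  halving-iterate U B k zero h = ≤-refl
  halving-iterate U B k (suc e) h = begin
    2 * 2 ^ e * U ^ (k + e * k)          ≡⟨ cong (2 * 2 ^ e *_) (^-distribˡ-+-* U k (e * k)) ⟩
    2 * 2 ^ e * (U ^ k * U ^ (e * k))    ≡⟨ solve 4 (λ a b c d → a :* b :* (c :* d) := (a :* c) :* (b :* d)) refl 2 (2 ^ e) (U ^ k) (U ^ (e * k)) ⟩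
    (2 * U ^ k) * (2 ^ e * U ^ (e * k))  ≤⟨ *-mono-≤ h (halving-iterate U B k e h) ⟩
    B ^ k * B ^ (e * k)                  ≡⟨ sym (^-distribˡ-+-* B k (e * k)) ⟩
    B ^ (k + e * k)                      ∎

  ratio-mono : ∀ U B c R t → U ≤ B → c * U ^ R ≤ B ^ R → c * U ^ (R + t) ≤ B ^ (R + t)
  ratio-mono U B c R t U≤B h = begin
    c * U ^ (R + t)      ≡⟨ cong (c *_) (^-distribˡ-+-* U R t) ⟩
    c * (U ^ R * U ^ t)  ≡⟨ sym (*-assoc c _ _) ⟩
    c * U ^ R * U ^ t    ≤⟨ *-mono-≤ h (^-monoˡ-≤ t U≤B) ⟩
    B ^ R * B ^ t        ≡⟨ sym (^-distribˡ-+-* B R t) ⟩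
    B ^ (R + t)          ∎

  cube : ℕ → ℕ
  cube c = c * c * c

  cube-mono : ∀ {x y} → x ≤ y → cube x ≤ cube y
  cube-mono h = *-mono-≤ (*-mono-≤ h h) h

  cube-* : ∀ m x → cube (m * x) ≡ cube m * cube x
  cube-* = solve 2 (λ m x → (m :* x) :* (m :* x) :* (m :* x) := (m :* m :* m) :* (x :* x :* x)) refl

  cubeRoot : ∀ N → 1 ≤ N → Σ ℕ λ c → 1 ≤ c × N ≤ cube c × cube c ≤ 8 * N
  cubeRoot N N≥1 = search N (begin
    N                      ≤⟨ m≤m*n N (suc N) ⟩
    N * suc N              ≤⟨ m≤m*n (N * suc N) (suc N) ⟩
    N * suc N * suc N      ≤⟨ *-monoˡ-≤ (suc N) (*-monoˡ-≤ (suc N) (n≤1+n N)) ⟩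
    cube (suc N)           ∎)
    where
    search : ∀ u → N ≤ cube (suc u) → Σ ℕ λ c → 1 ≤ c × N ≤ cube c × cube c ≤ 8 * N
    search zero h = 1 , ≤-refl , h , ≤-trans N≥1 (m≤n*m N 8)
    search (suc u) h with N ≤? cube (suc u)
    ... | yes h′ = search u h′
    ... | no h′ = suc (suc u) , s≤s z≤n , h , (begin
      cube (suc (suc u))  ≤⟨ cube-mono (≤-trans (m≤n+m (suc (suc u)) u) (≤-reflexive (solve 1 (λ u → u :+ (con 2 :+ u) := con 2 :* (con 1 :+ u)) refl u))) ⟩
      cube (2 * suc u)    ≡⟨ cube-* 2 (suc u) ⟩
      8 * cube (suc u)    ≤⟨ *-monoʳ-≤ 8 (<⇒≤ (≰⇒> h′)) ⟩
      8 * N               ∎)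

  n<2^[1+log₂n] : ∀ n → 1 ≤ n → n < 2 ^ suc ⌊log₂ n ⌋
  n<2^[1+log₂n] n n≥1 with dyadic n n≥1
    where
    dyadic : ∀ n → 1 ≤ n → Σ ℕ λ e → 2 ^ e ≤ n × n < 2 ^ suc e
    dyadic .1 (s≤s {n = zero} z≤n) = 0 , ≤-refl , s≤s (s≤s z≤n)
    dyadic (suc (suc n)) (s≤s z≤n) with dyadic (suc n) (s≤s z≤n)
    ... | e , lo , hi with suc (suc n) <? 2 ^ suc e
    ... | yes lt = e , ≤-trans lo (n≤1+n _) , lt
    ... | no ¬lt = suc e , ≮⇒≥ ¬lt , (begin-strict
      suc (suc n)              ≡⟨ ≤-antisym hi (≮⇒≥ ¬lt) ⟩
      2 ^ suc e                <⟨ m<m+n (2 ^ suc e) (m^n>0 2 (suc e)) ⟩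
      2 ^ suc e + 2 ^ suc e    ≡⟨ cong (2 ^ suc e +_) (sym (+-identityʳ _)) ⟩
      2 ^ suc (suc e)          ∎)
  ... | e , lo , hi = <-≤-trans hi (^-monoʳ-≤ 2 (s≤s (≤-trans (≤-reflexive (sym (⌊log₂[2^n]⌋≡n e))) (⌊log₂⌋-mono-≤ lo))))

-- A labelling of the grid Fin n × Fin n by labels 0,…,S, label 0 meaning
-- "no label": a non-zero label occurs at most once in each row and in each
-- column, so its occurrences form a partial matching, and each row has at most
-- one unlabelled cell.  Labelling (j , l) by the position of aⱼ + aₗ (j ≠ l) in
-- an enumeration of A +̂ A, or of aⱼ − aₗ in one of A − A, gives such a labelling.
record Labelling (n S : ℕ) : Set where
  field
    κ               : Fin n → Fin n → ℕ
    κ≤S             : ∀ j l → κ j l ≤ S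
    rowInjective    : ∀ j l l′ → κ j l ≡ κ j l′ → ¬ κ j l ≡ 0 → l ≡ l′
    columnInjective : ∀ j j′ l → κ j l ≡ κ j′ l → ¬ κ j l ≡ 0 → j ≡ j′
    unlabelledOnce  : ∀ a i i′ → κ a i ≡ 0 → κ a i′ ≡ 0 → i ≡ i′

module Popularity {n S : ℕ} (L : Labelling n S) where

  open import Data.Nat
  open import Data.Nat.Properties
  open import Data.Bool using (Bool; true; false; not; _∧_)
  open import Data.Fin using (Fin; suc; toℕ)
  open import Data.Product using (Σ; _,_; _×_)
  open import Function using (_∘_)
  open import Relation.Binary.PropositionalEquality
  open ≤-Reasoning
  open Labelling L
  open BooleanTests
  open FiniteSums

  occurrences : ℕ → ℕ
  occurrences k = ∑ (λ j → count (λ l → κ j l ≡ᵇ k))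

  unpopular popular : ℕ → ℕ → Bool
  unpopular R k = not (k ≡ᵇ 0) ∧ (occurrences k <ᵇ R)
  popular R k = not (k ≡ᵇ 0) ∧ not (occurrences k <ᵇ R)

  unpopularInRow : ℕ → Fin n → ℕ
  unpopularInRow R a = count (λ i → unpopular R (κ a i))

  rowsWith : ℕ → Fin n → Bool
  rowsWith k j = anyᶠ (λ l → κ j l ≡ᵇ k)

  labelledInRow≤1 : ∀ k → ¬ k ≡ 0 → ∀ j → count (λ l → κ j l ≡ᵇ k) ≤ 1
  labelledInRow≤1 k k≢0 j = count≤1 (λ l → κ j l ≡ᵇ k) (λ l l′ e e′ →
    let κ≡k = ≡ᵇ-sound _ _ e ; κ′≡k = ≡ᵇ-sound _ _ e′
    in rowInjective j l l′ (trans κ≡k (sym κ′≡k)) (λ z → k≢0 (trans (sym κ≡k) z)))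

  rowsWith-count : ∀ k → ¬ k ≡ 0 → count (rowsWith k) ≡ occurrences k
  rowsWith-count k k≢0 = ∑-cong (λ j → χ-anyᶠ (λ l → κ j l ≡ᵇ k) (labelledInRow≤1 k k≢0 j))

  popular-sound : ∀ R k → popular R k ≡ true → ¬ k ≡ 0 × R ≤ count (rowsWith k)
  popular-sound R k e with ∧-elim {not (k ≡ᵇ 0)} e
  ... | nonzero , frequent = k≢0 , subst (R ≤_) (sym (rowsWith-count k k≢0)) R≤occ
    where
    k≢0 : ¬ k ≡ 0
    k≢0 refl with not-true nonzero
    ... | ()
    R≤occ : R ≤ occurrences k
    R≤occ = ≮⇒≥ (λ lt → true≢false (trans (sym (T⇒≡true (<⇒<ᵇ lt))) (not-true frequent)))

  -- Every non-zero unpopular label occurs on fewer than R cells, so altogether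
  -- there are at most S · R unpopular cells.
  unpopularTotal : ∀ R → ∑ (unpopularInRow R) ≤ S * R
  unpopularTotal R = begin
    ∑ (λ a → ∑ (λ i → χ (unpopular R (κ a i))))
      ≡⟨ ∑-cong {n} (λ a → ∑-fibres S (χ ∘ unpopular R) (κ a) (κ≤S a)) ⟩
    ∑ (λ a → ∑ {suc S} (λ k → χ (unpopular R (toℕ k)) * count (λ i → κ a i ≡ᵇ toℕ k)))
      ≡⟨ ∑-swap {n} {suc S} (λ a k → χ (unpopular R (toℕ k)) * count (λ i → κ a i ≡ᵇ toℕ k)) ⟩
    ∑ {suc S} (λ k → ∑ (λ a → χ (unpopular R (toℕ k)) * count (λ i → κ a i ≡ᵇ toℕ k)))
      ≡⟨ ∑-cong {suc S} (λ k → ∑-*ˡ (χ (unpopular R (toℕ k))) (λ a → count (λ i → κ a i ≡ᵇ toℕ k))) ⟩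
    ∑ {suc S} (λ k → χ (unpopular R (toℕ k)) * occurrences (toℕ k))
      ≤⟨ ∑-mono {suc S} (λ k → unpopular-weight (toℕ k)) ⟩
    ∑ {suc S} (λ k → χ (not (toℕ k ≡ᵇ 0)) * R)
      ≡⟨ trans (∑-cong {S} (λ k → +-identityʳ R)) (∑-const {S} R) ⟩
    S * R ∎
    where
    unpopular-weight : ∀ k → χ (unpopular R k) * occurrences k ≤ χ (not (k ≡ᵇ 0)) * R
    unpopular-weight zero = z≤n
    unpopular-weight (suc k) with occurrences (suc k) <ᵇ R in lt
    ... | true = +-monoˡ-≤ 0 (<⇒≤ (<ᵇ⇒< (occurrences (suc k)) R (≡true⇒T lt)))
    ... | false = z≤n

  quietRow : ∀ R → 1 ≤ n → Σ (Fin n) λ a → n * unpopularInRow R a ≤ S * R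
  quietRow R n≥1 with ∃≤mean n≥1 (unpopularInRow R)
  ... | a , belowMean = a , ≤-trans belowMean (unpopularTotal R)

  -- The cells of row a whose label is not popular are its unlabelled cell
  -- (at most one) and its unpopular cells.
  notPopularInRow : ∀ R a → count (λ i → not (popular R (κ a i))) ≤ 1 + unpopularInRow R a
  notPopularInRow R a = begin
    count (λ i → not (popular R (κ a i)))
      ≤⟨ ∑-mono (λ i → split (κ a i ≡ᵇ 0) (occurrences (κ a i) <ᵇ R)) ⟩
    ∑ (λ i → χ (κ a i ≡ᵇ 0) + χ (unpopular R (κ a i)))
      ≡⟨ ∑-+ (λ i → χ (κ a i ≡ᵇ 0)) (λ i → χ (unpopular R (κ a i))) ⟩
    count (λ i → κ a i ≡ᵇ 0) + unpopularInRow R a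
      ≤⟨ +-monoˡ-≤ (unpopularInRow R a) unlabelled≤1 ⟩
    1 + unpopularInRow R a ∎
    where
    split : ∀ x y → χ (not (not x ∧ not y)) ≤ χ x + χ (not x ∧ y)
    split true y = s≤s z≤n
    split false true = s≤s z≤n
    split false false = z≤n
    unlabelled≤1 : count (λ i → κ a i ≡ᵇ 0) ≤ 1
    unlabelled≤1 = count≤1 (λ i → κ a i ≡ᵇ 0) (λ i i′ e e′ → unlabelledOnce a i i′ (≡ᵇ-sound _ _ e) (≡ᵇ-sound _ _ e′))

-- For b = a + d a vector f ∈ Vec (Fin b) n chooses the set
-- X_f = {j : f j < a}; over all bⁿ vectors every j is chosen in a out of b
-- cases, independently.  For a non-zero label k occurring in r rows, the pairs
-- (f , g) for which no cell labelled k lies in X_f × X_g number at most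
-- Uʳ · Bⁿ⁻ʳ, where U = b² − a² and B = b²: the probability (1 − a²/b²)ʳ.
module RandomSubsets {n S : ℕ} (L : Labelling n S) (a d : ℕ) where

  open import Data.Nat
  open import Data.Nat.Properties
  open import Data.Bool using (Bool; true; false; not; _∧_; if_then_else_)
  open import Data.Fin using (Fin; toℕ)
  open import Data.Vec using (Vec; lookup)
  open import Data.Product using (Σ; _,_; _×_; proj₁)
  open import Function using (_∘_)
  open import Relation.Binary.PropositionalEquality
  open ≤-Reasoning
  open Labelling L
  open Popularity L using (rowsWith)
  open BooleanTests
  open FiniteSums
  open SumsOverVectors

  b U B : ℕ
  b = a + d
  U = d * a + b * d
  B = b * b

  chosen : Vec (Fin b) n → Fin n → Bool
  chosen f j = toℕ (lookup f j) <ᵇ a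

  inChosenRow : ℕ → Vec (Fin b) n → Fin n → Fin n → Bool
  inChosenRow k f j l = (κ j l ≡ᵇ k) ∧ chosen f j

  hits : ℕ → Vec (Fin b) n → Vec (Fin b) n → Bool
  hits k f g = anyᶠ (λ j → anyᶠ (λ l → inChosenRow k f j l ∧ chosen g l))

  hits-sound : ∀ k f g → hits k f g ≡ true →
    Σ (Fin n) λ j → Σ (Fin n) λ l → chosen f j ≡ true × chosen g l ≡ true × κ j l ≡ k
  hits-sound k f g hit with anyᶠ-elim _ hit
  ... | j , rowHit with anyᶠ-elim _ rowHit
  ... | l , cell with ∧-elim {inChosenRow k f j l} cell
  ... | labelledInRow , lChosen with ∧-elim {κ j l ≡ᵇ k} labelledInRow
  ... | labelled , jChosen = j , l , jChosen , lChosen , ≡ᵇ-sound _ _ labelled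

  partnerColumns chosenRowsWith : ℕ → Vec (Fin b) n → Fin n → Bool
  partnerColumns k f l = anyᶠ (λ j → inChosenRow k f j l)
  chosenRowsWith k f j = anyᶠ (λ l → inChosenRow k f j l)

  miss≤ : ∀ k f g → χ (not (hits k f g)) ≤ ∏ (λ l → if partnerColumns k f l ∧ chosen g l then 0 else 1)
  miss≤ k f g with hits k f g in hit
  ... | true = z≤n
  ... | false = ≤-reflexive (sym (∏-ones _ notChosen))
    where
    notChosen : ∀ l → (if partnerColumns k f l ∧ chosen g l then 0 else 1) ≡ 1
    notChosen l with partnerColumns k f l ∧ chosen g l in e
    ... | false = refl
    ... | true with ∧-elim e
    ... | partner , lChosen with anyᶠ-elim (λ j → inChosenRow k f j l) partner
    ... | j , cell with trans (sym hit) (anyᶠ-intro _ j (anyᶠ-intro _ l (∧-intro cell lChosen)))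
    ... | ()

  -- By column-injectivity each column holds at most one such cell, and by
  -- row-injectivity each row does, so partner columns and rows are equinumerous.
  partnerColumns-count : ∀ k → ¬ k ≡ 0 → ∀ f → count (partnerColumns k f) ≡ count (chosenRowsWith k f)
  partnerColumns-count k k≢0 f = begin-equality
    ∑ (λ l → χ (partnerColumns k f l))        ≡⟨ ∑-cong (λ l → χ-anyᶠ (λ j → inChosenRow k f j l) (inColumn≤1 l)) ⟩
    ∑ (λ l → ∑ (λ j → χ (inChosenRow k f j l))) ≡⟨ ∑-swap {n} {n} (λ l j → χ (inChosenRow k f j l)) ⟩
    ∑ (λ j → ∑ (λ l → χ (inChosenRow k f j l))) ≡⟨ sym (∑-cong (λ j → χ-anyᶠ (λ l → inChosenRow k f j l) (inRow≤1 j))) ⟩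
    ∑ (λ j → χ (chosenRowsWith k f j))        ∎
    where
    labelled : ∀ {j l} → inChosenRow k f j l ≡ true → κ j l ≡ k
    labelled e = ≡ᵇ-sound _ _ (proj₁ (∧-elim e))
    inRow≤1 : ∀ j → count (λ l → inChosenRow k f j l) ≤ 1
    inRow≤1 j = count≤1 _ (λ l l′ e e′ →
      rowInjective j l l′ (trans (labelled e) (sym (labelled e′))) (λ z → k≢0 (trans (sym (labelled e)) z)))
    inColumn≤1 : ∀ l → count (λ j → inChosenRow k f j l) ≤ 1
    inColumn≤1 l = count≤1 _ (λ j j′ e e′ →
      columnInjective j j′ l (trans (labelled e) (sym (labelled e′))) (λ z → k≢0 (trans (sym (labelled e)) z)))

  chosen-count : count {b} (λ x → toℕ x <ᵇ a) ≡ a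
  chosen-count = count-< b a (m≤m+n a d)

  unchosen-count : count {b} (not ∘ (λ x → toℕ x <ᵇ a)) ≡ d
  unchosen-count = +-cancelˡ-≡ a _ _ (subst (λ t → t + count {b} (not ∘ (λ x → toℕ x <ᵇ a)) ≡ b) chosen-count (count-compl {b} _))

  avoid-one : ∀ t → ∑ {b} (λ x → if t ∧ (toℕ x <ᵇ a) then 0 else 1) ≡ (if t then d else b)
  avoid-one true = trans (∑-if {b} (λ x → toℕ x <ᵇ a) 0 1) (trans (+-identityʳ _) unchosen-count)
  avoid-one false = trans (∑-const {b} 1) (*-identityʳ b)

  avoid-pair : ∀ t → ∑ {b} (λ x → if t ∧ (toℕ x <ᵇ a) then d else b) ≡ (if t then U else B)
  avoid-pair true = trans (∑-if {b} (λ x → toℕ x <ᵇ a) d b) (cong₂ (λ p q → d * p + b * q) chosen-count unchosen-count)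
  avoid-pair false = ∑-const {b} b

  misses : ∀ k → ¬ k ≡ 0 →
    ∑ᵛ b n (λ f → ∑ᵛ b n (λ g → χ (not (hits k f g)))) ≤ U ^ count (rowsWith k) * B ^ count (not ∘ rowsWith k)
  misses k k≢0 = begin
    ∑ᵛ b n (λ f → ∑ᵛ b n (λ g → χ (not (hits k f g))))
      ≤⟨ ∑ᵛ-mono b n (λ f → ∑ᵛ-mono b n (λ g → miss≤ k f g)) ⟩
    ∑ᵛ b n (λ f → ∑ᵛ b n (λ g → ∏ (λ l → if partnerColumns k f l ∧ chosen g l then 0 else 1)))
      ≡⟨ ∑ᵛ-cong b n (λ f → trans (∑ᵛ-∏ b n (λ l x → if partnerColumns k f l ∧ (toℕ x <ᵇ a) then 0 else 1))
                                   (∏-cong (λ l → avoid-one (partnerColumns k f l)))) ⟩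
    ∑ᵛ b n (λ f → ∏ (λ l → if partnerColumns k f l then d else b))
      ≡⟨ ∑ᵛ-cong b n (λ f → ∏-if-count (partnerColumns k f) (chosenRowsWith k f) d b (partnerColumns-count k k≢0 f)) ⟩
    ∑ᵛ b n (λ f → ∏ (λ j → if chosenRowsWith k f j then d else b))
      ≡⟨ ∑ᵛ-cong b n (λ f → ∏-cong (λ j → cong (if_then d else b) (anyᶠ-∧ʳ (λ l → κ j l ≡ᵇ k) (chosen f j)))) ⟩
    ∑ᵛ b n (λ f → ∏ (λ j → if rowsWith k j ∧ chosen f j then d else b))
      ≡⟨ ∑ᵛ-∏ b n (λ j x → if rowsWith k j ∧ (toℕ x <ᵇ a) then d else b) ⟩
    ∏ (λ j → ∑ {b} (λ x → if rowsWith k j ∧ (toℕ x <ᵇ a) then d else b))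
      ≡⟨ ∏-cong (λ j → avoid-pair (rowsWith k j)) ⟩
    ∏ (λ j → if rowsWith k j then U else B)
      ≡⟨ ∏-if (rowsWith k) U B ⟩
    U ^ count (rowsWith k) * B ^ count (not ∘ rowsWith k) ∎

-- Suppose a popular label (one occurring in at least
-- R rows) is missed by X_f × X_g with probability at most 1/(4n), i.e.
-- 4n · Uᴿ ≤ Bᴿ.  By the union bound all popular labels of a given row are hit
-- except with probability 1/4, and by Markov's inequality |X_f| + |X_g| < 4a
-- except with probability 1/2; so some pair (f , g) has both properties.
module GoodPair {n S : ℕ} (L : Labelling n S) (a d : ℕ) (a≥1 : 1 ≤ a) (a+d≡n : a + d ≡ n) (R : ℕ)
    (rare : 4 * n * RandomSubsets.U L a d ^ R ≤ RandomSubsets.B L a d ^ R) (row : Fin n) where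

  open import Data.Nat
  open import Data.Nat.Properties
  open import Data.Bool using (Bool; true; false; not; _∧_)
  open import Data.Fin using (Fin)
  open import Data.Vec using (Vec)
  open import Data.Product using (Σ; _,_; _×_)
  open import Function using (_∘_)
  open import Relation.Binary.PropositionalEquality
  open ≤-Reasoning
  open import Data.Nat.Solver using (module +-*-Solver)
  open +-*-Solver using (solve; _:+_; _:*_; _:=_; con)
  open Labelling L
  open Popularity L using (popular; popular-sound; rowsWith)
  open RandomSubsets L a d
  open BooleanTests
  open FiniteSums
  open SumsOverVectors
  open Arithmetic

  size : Vec (Fin b) n → ℕ
  size f = count (chosen f)

  tooLarge : Vec (Fin b) n → Vec (Fin b) n → Bool
  tooLarge f g = 4 * a ≤ᵇ size f + size g

  missed : Vec (Fin b) n → Vec (Fin b) n → Fin n → Bool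
  missed f g i = popular R (κ row i) ∧ not (hits (κ row i) f g)

  bad : Vec (Fin b) n → Vec (Fin b) n → ℕ
  bad f g = χ (tooLarge f g) + count (missed f g)

  b≥1 : 1 ≤ b
  b≥1 = ≤-trans a≥1 (m≤m+n a d)

  Bⁿ≡ : B ^ n ≡ b ^ n * b ^ n
  Bⁿ≡ = ^-distribʳ-* b b n

  ∑ᵛ-zero : ∑ᵛ b n (λ _ → 0) ≡ 0
  ∑ᵛ-zero = trans (∑ᵛ-const b n 0) (*-zeroʳ (b ^ n))

  size-total : ∑ᵛ b n size ≡ a * b ^ n
  size-total = *-cancelˡ-≡ _ _ b {{>-nonZero b≥1}} (begin-equality
    b * ∑ᵛ b n size                                   ≡⟨ cong (b *_) (∑ᵛ-∑ b n (λ j f → χ (chosen f j))) ⟩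
    b * ∑ (λ j → ∑ᵛ b n (λ f → χ (chosen f j)))         ≡⟨ sym (∑-*ˡ {n} b (λ j → ∑ᵛ b n (λ f → χ (chosen f j)))) ⟩
    ∑ (λ j → b * ∑ᵛ b n (λ f → χ (chosen f j)))         ≡⟨ ∑-cong (∑ᵛ-coordinate< b n a (m≤m+n a d)) ⟩
    ∑ {n} (λ j → a * b ^ n)                            ≡⟨ ∑-const {n} _ ⟩
    n * (a * b ^ n)                                   ≡⟨ cong (_* (a * b ^ n)) (sym a+d≡n) ⟩
    b * (a * b ^ n)                                   ∎)

  markov : ∀ s → 4 * a * χ (4 * a ≤ᵇ s) ≤ s
  markov s with 4 * a ≤ᵇ s in e
  ... | true = ≤-trans (≤-reflexive (*-identityʳ _)) (≤ᵇ⇒≤ (4 * a) s (≡true⇒T e))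
  ... | false = ≤-trans (≤-reflexive (*-zeroʳ (4 * a))) z≤n

  -- |X_f| + |X_g| ≥ 4a for at most half of all pairs, as its mean is 2a.
  rarelyTooLarge : 2 * ∑ᵛ b n (λ f → ∑ᵛ b n (λ g → χ (tooLarge f g))) ≤ B ^ n
  rarelyTooLarge = *-cancelˡ-≤ (2 * a) {{>-nonZero (≤-trans a≥1 (m≤n*m a 2))}} (begin
    2 * a * (2 * T)
      ≡⟨ solve 2 (λ a x → con 2 :* a :* (con 2 :* x) := con 4 :* a :* x) refl a T ⟩
    4 * a * T
      ≡⟨ trans (sym (∑ᵛ-*ˡ b n (4 * a) _)) (∑ᵛ-cong b n (λ f → sym (∑ᵛ-*ˡ b n (4 * a) _))) ⟩
    ∑ᵛ b n (λ f → ∑ᵛ b n (λ g → 4 * a * χ (tooLarge f g)))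
      ≤⟨ ∑ᵛ-mono b n (λ f → ∑ᵛ-mono b n (λ g → markov (size f + size g))) ⟩
    ∑ᵛ b n (λ f → ∑ᵛ b n (λ g → size f + size g))
      ≡⟨ ∑ᵛ-cong b n (λ f → trans (∑ᵛ-+ b n (λ _ → size f) size) (cong₂ _+_ (∑ᵛ-const b n (size f)) size-total)) ⟩
    ∑ᵛ b n (λ f → b ^ n * size f + a * b ^ n)
      ≡⟨ trans (∑ᵛ-+ b n (λ f → b ^ n * size f) (λ _ → a * b ^ n))
               (cong₂ _+_ (trans (∑ᵛ-*ˡ b n (b ^ n) size) (cong (b ^ n *_) size-total)) (∑ᵛ-const b n _)) ⟩
    b ^ n * (a * b ^ n) + b ^ n * (a * b ^ n)
      ≡⟨ solve 2 (λ p a → p :* (a :* p) :+ p :* (a :* p) := con 2 :* a :* (p :* p)) refl (b ^ n) a ⟩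
    2 * a * (b ^ n * b ^ n)
      ≡⟨ cong (2 * a *_) (sym Bⁿ≡) ⟩
    2 * a * B ^ n ∎)
    where
    T = ∑ᵛ b n (λ f → ∑ᵛ b n (λ g → χ (tooLarge f g)))

  -- U = b² − a² ≤ b² = B.
  U≤B : U ≤ B
  U≤B = begin
    d * a + b * d  ≤⟨ +-monoˡ-≤ (b * d) (*-monoˡ-≤ a (m≤n+m d a)) ⟩
    b * a + b * d  ≡⟨ sym (*-distribˡ-+ b a d) ⟩
    b * b          ∎

  rarelyMissed : ∀ i → 4 * n * ∑ᵛ b n (λ f → ∑ᵛ b n (λ g → χ (missed f g i))) ≤ B ^ n
  rarelyMissed i with popular R (κ row i) in isPopular
  ... | false = ≤-trans (≤-reflexive (trans (cong (4 * n *_) (trans (∑ᵛ-cong b n (λ f → ∑ᵛ-zero)) ∑ᵛ-zero)) (*-zeroʳ (4 * n)))) z≤n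
  ... | true with popular-sound R (κ row i) isPopular
  ... | k≢0 , R≤r = begin
    4 * n * ∑ᵛ b n (λ f → ∑ᵛ b n (λ g → χ (not (hits k f g)))) ≤⟨ *-monoʳ-≤ (4 * n) (misses k k≢0) ⟩
    4 * n * (U ^ r * B ^ r′)                                  ≡⟨ sym (*-assoc (4 * n) _ _) ⟩
    4 * n * U ^ r * B ^ r′                                    ≤⟨ *-monoˡ-≤ (B ^ r′) (subst (λ t → 4 * n * U ^ t ≤ B ^ t) (m+[n∸m]≡n R≤r) (ratio-mono U B (4 * n) R (r ∸ R) U≤B rare)) ⟩
    B ^ r * B ^ r′                                            ≡⟨ sym (^-distribˡ-+-* B r r′) ⟩
    B ^ (r + r′)                                              ≡⟨ cong (B ^_) (count-compl (rowsWith k)) ⟩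
    B ^ n                                                     ∎
    where
    k = κ row i
    r = count (rowsWith k)
    r′ = count (not ∘ rowsWith k)

  -- Union bound over the n cells of the row.
  rarelyAnyMissed : 4 * ∑ᵛ b n (λ f → ∑ᵛ b n (λ g → count (missed f g))) ≤ B ^ n
  rarelyAnyMissed = *-cancelˡ-≤ n {{>-nonZero (subst (1 ≤_) a+d≡n b≥1)}} (begin
    n * (4 * M)
      ≡⟨ solve 2 (λ n z → n :* (con 4 :* z) := con 4 :* n :* z) refl n M ⟩
    4 * n * M
      ≡⟨ cong (4 * n *_) (trans (∑ᵛ-cong b n (λ f → ∑ᵛ-∑ b n (λ i g → χ (missed f g i)))) (∑ᵛ-∑ b n (λ i f → ∑ᵛ b n (λ g → χ (missed f g i))))) ⟩
    4 * n * ∑ (λ i → ∑ᵛ b n (λ f → ∑ᵛ b n (λ g → χ (missed f g i))))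
      ≡⟨ sym (∑-*ˡ {n} (4 * n) (λ i → ∑ᵛ b n (λ f → ∑ᵛ b n (λ g → χ (missed f g i))))) ⟩
    ∑ (λ i → 4 * n * ∑ᵛ b n (λ f → ∑ᵛ b n (λ g → χ (missed f g i))))
      ≤⟨ ∑-mono rarelyMissed ⟩
    ∑ {n} (λ i → B ^ n)
      ≡⟨ ∑-const {n} _ ⟩
    n * B ^ n ∎)
    where
    M = ∑ᵛ b n (λ f → ∑ᵛ b n (λ g → count (missed f g)))

  fewBad : ∑ᵛ b n (λ f → ∑ᵛ b n (λ g → bad f g)) < ∑ᵛ b n (λ f → ∑ᵛ b n (λ g → 1))
  fewBad = *-cancelˡ-< 4 _ _ (begin-strict
    4 * ∑ᵛ b n (λ f → ∑ᵛ b n (λ g → bad f g)) ≡⟨ cong (4 *_) (trans (∑ᵛ-cong b n (λ f → ∑ᵛ-+ b n _ _)) (∑ᵛ-+ b n _ _)) ⟩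
    4 * (T + M)                               ≡⟨ solve 2 (λ x z → con 4 :* (x :+ z) := con 2 :* (con 2 :* x) :+ con 4 :* z) refl T M ⟩
    2 * (2 * T) + 4 * M                       ≤⟨ +-mono-≤ (*-monoʳ-≤ 2 rarelyTooLarge) rarelyAnyMissed ⟩
    2 * B ^ n + B ^ n                         <⟨ +-monoʳ-< (2 * B ^ n) (m<m+n (B ^ n) {B ^ n} (1≤m^n B n (*-mono-≤ b≥1 b≥1))) ⟩
    2 * B ^ n + (B ^ n + B ^ n)               ≡⟨ solve 1 (λ p → con 2 :* p :+ (p :+ p) := con 4 :* p) refl (B ^ n) ⟩
    4 * B ^ n                                 ≡⟨ cong (4 *_) (sym total) ⟩
    4 * ∑ᵛ b n (λ f → ∑ᵛ b n (λ g → 1))        ∎)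
    where
    T = ∑ᵛ b n (λ f → ∑ᵛ b n (λ g → χ (tooLarge f g)))
    M = ∑ᵛ b n (λ f → ∑ᵛ b n (λ g → count (missed f g)))
    total : ∑ᵛ b n (λ f → ∑ᵛ b n (λ g → 1)) ≡ B ^ n
    total = trans (∑ᵛ-cong b n (λ f → ∑ᵛ-const b n 1))
      (trans (∑ᵛ-const b n _) (trans (cong (b ^ n *_) (*-identityʳ _)) (sym Bⁿ≡)))

  goodPair : Σ (Vec (Fin b) n) λ f → Σ (Vec (Fin b) n) λ g →
    size f + size g < 4 * a × (∀ i → popular R (κ row i) ≡ true → hits (κ row i) f g ≡ true)
  goodPair with ∑ᵛ<∑ᵛ⇒∃< b n _ _ fewBad
  ... | f , lt with ∑ᵛ<∑ᵛ⇒∃< b n _ _ lt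
  ... | g , bad<1 = f , g , small , allHit
    where
    bad≡0 : bad f g ≡ 0
    bad≡0 = n≤0⇒n≡0 (≤-pred bad<1)
    small : size f + size g < 4 * a
    small = ≰⇒> (λ large → 1≢0 (trans (cong χ (sym (T⇒≡true (≤⇒≤ᵇ large)))) (m+n≡0⇒m≡0 _ bad≡0)))
      where
      1≢0 : ¬ 1 ≡ 0
      1≢0 ()
    allHit : ∀ i → popular R (κ row i) ≡ true → hits (κ row i) f g ≡ true
    allHit i isPopular = not-false (χ≡0 (∑≡0⇒≡0 (χ ∘ missed f g) (m+n≡0⇒n≡0 _ bad≡0) i))
      where
      χ≡0 : χ (popular R (κ row i) ∧ not (hits (κ row i) f g)) ≡ 0 → not (hits (κ row i) f g) ≡ false
      χ≡0 rewrite isPopular with not (hits (κ row i) f g)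
      ... | false = λ _ → refl

module SubsetsFromTests where

  open import Data.Nat using (zero; suc)
  open import Data.Bool using (Bool; true; false; not)
  open import Data.Fin using (Fin; zero; suc)
  open import Data.Fin.Subset using (Subset; _∈_; ∁; ∣_∣)
  open import Data.Vec using (tabulate)
  open import Data.Vec.Properties using (lookup∘tabulate; lookup⇒[]=; []=⇒lookup)
  open import Function using (_∘_)
  open import Relation.Binary.PropositionalEquality
  open FiniteSums using (count)

  ⟦_⟧ : ∀ {n} → (Fin n → Bool) → Subset n
  ⟦ p ⟧ = tabulate p

  ∣⟦⟧∣ : ∀ {n} (p : Fin n → Bool) → ∣ ⟦ p ⟧ ∣ ≡ count p
  ∣⟦⟧∣ {zero} p = refl
  ∣⟦⟧∣ {suc n} p with p zero
  ... | true = cong suc (∣⟦⟧∣ (p ∘ suc))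
  ... | false = ∣⟦⟧∣ (p ∘ suc)

  ∣∁⟦⟧∣ : ∀ {n} (p : Fin n → Bool) → ∣ ∁ ⟦ p ⟧ ∣ ≡ count (not ∘ p)
  ∣∁⟦⟧∣ {zero} p = refl
  ∣∁⟦⟧∣ {suc n} p with p zero
  ... | true = ∣∁⟦⟧∣ (p ∘ suc)
  ... | false = cong suc (∣∁⟦⟧∣ (p ∘ suc))

  ∈⟦⟧ : ∀ {n} (p : Fin n → Bool) i → p i ≡ true → i ∈ ⟦ p ⟧
  ∈⟦⟧ p i e = lookup⇒[]= i (tabulate p) (trans (lookup∘tabulate p i) e)

  ∈⟦⟧⁻ : ∀ {n} (p : Fin n → Bool) i → i ∈ ⟦ p ⟧ → p i ≡ true
  ∈⟦⟧⁻ p i m = trans (sym (lookup∘tabulate p i)) ([]=⇒lookup m)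

module Covering where

  open import Data.Nat
  open import Data.Nat.Properties
  open import Data.Nat.DivMod
  open import Data.Nat.Logarithm using (⌊log₂_⌋; ⌊log₂⌋-mono-≤)
  open import Data.Bool using (Bool; true; false; not; _∨_)
  open import Data.Fin using (Fin; fromℕ<)
  open import Data.Fin.Subset using (Subset; _∈_; ∁; ∣_∣)
  open import Data.Product using (Σ; _,_; _×_; proj₁; proj₂)
  open import Data.Empty using (⊥-elim)
  open import Data.Sum using ([_,_]′)
  open import Function using (_∘_)
  open import Relation.Binary.PropositionalEquality
  open ≤-Reasoning
  open import Data.Nat.Solver using (module +-*-Solver)
  open +-*-Solver using (solve; _:+_; _:*_; _:=_; con)
  open BooleanTests
  open FiniteSums
  open Arithmetic
  open SubsetsFromTests

  PairIn : ∀ {ℓ n} → Subset n → (Fin n → Fin n → Set ℓ) → Set ℓ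
  PairIn {n = n} A₀′ R = Σ (Fin n) λ j → Σ (Fin n) λ l → j ∈ A₀′ × l ∈ A₀′ × R j l

  CoverWith : ∀ {ℓ} (n s : ℕ) → (Fin n → Fin n → Fin n → Fin n → Set ℓ) → Set ℓ
  CoverWith n s P = Σ (Fin n) λ a* → Σ (Subset n) λ A₀′ → Σ (Subset n) λ A₁ →
    WithinBound 20 n s (∣ A₀′ ∣ + ∣ ∁ A₁ ∣) × (∀ i → i ∈ A₁ → PairIn A₀′ (P a* i))

  CoverWith-map : ∀ {ℓ ℓ′ n s} {P : Fin n → Fin n → Fin n → Fin n → Set ℓ} {Q : Fin n → Fin n → Fin n → Fin n → Set ℓ′} →
    (∀ {a i j l} → P a i j l → Q a i j l) → CoverWith n s P → CoverWith n s Q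
  CoverWith-map {P = P} {Q} P⇒Q (a* , A₀′ , A₁ , bound , covers) = a* , A₀′ , A₁ , bound , λ i i∈A₁ → weaken (covers i i∈A₁)
    where
    weaken : ∀ {i} → PairIn A₀′ (P a* i) → PairIn A₀′ (Q a* i)
    weaken (j , l , j∈A₀′ , l∈A₀′ , p) = j , l , j∈A₀′ , l∈A₀′ , P⇒Q p

  SameLabel : ∀ {n s} → Labelling n s → Fin n → Fin n → Fin n → Fin n → Set
  SameLabel L a i j l = κ j l ≡ κ a i × ¬ κ a i ≡ 0
    where open Labelling L

  Cover : ∀ {n s} → Labelling n s → Set
  Cover {n} {s} L = CoverWith n s (SameLabel L)

  module _ {n s : ℕ} (n≥2 : 2 ≤ n) (s≥1 : 1 ≤ s) (L : Labelling n s) where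

    open Labelling L
    open Popularity L

    n≥1 : 1 ≤ n
    n≥1 = ≤-trans (s≤s z≤n) n≥2

    X : ℕ
    X = n * s * ⌊log₂ n ⌋

    -- A cost of at most 5c, where c³ ≤ 64 X, is within the bound: (5c)³ ≤ 20³ X.
    costWithinBound : ∀ c x → x ≤ 5 * c → cube c ≤ 64 * X → WithinBound 20 n s x
    costWithinBound c x x≤5c c³≤64X = subst (_≤ 8000 * X) (solve 1 (λ x → x :* x :* x := x :* (x :* (x :* con 1))) refl x) (begin
      cube x          ≤⟨ cube-mono x≤5c ⟩
      cube (5 * c)    ≡⟨ cube-* 5 c ⟩
      125 * cube c    ≤⟨ *-monoʳ-≤ 125 c³≤64X ⟩
      125 * (64 * X)  ≡⟨ sym (*-assoc 125 64 X) ⟩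
      8000 * X        ∎)

    -- The empty choice A₀′ = A₁ = ∅ costs n, which suffices when n ≤ c.
    emptyCover : ∀ c → n ≤ c → cube c ≤ 64 * X → Cover L
    emptyCover c n≤c c³≤64X = fromℕ< n≥1 , ⟦ none ⟧ , ⟦ none ⟧ , costWithinBound c _ cost≤5c c³≤64X ,
      λ i i∈∅ → ⊥-elim (true≢false (sym (∈⟦⟧⁻ none i i∈∅)))
      where
      none : Fin n → Bool
      none _ = false
      cost≤5c : ∣ ⟦ none ⟧ ∣ + ∣ ∁ ⟦ none ⟧ ∣ ≤ 5 * c
      cost≤5c = begin
        ∣ ⟦ none ⟧ ∣ + ∣ ∁ ⟦ none ⟧ ∣  ≡⟨ trans (cong₂ _+_ (∣⟦⟧∣ none) (∣∁⟦⟧∣ none)) (count-compl none) ⟩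
        n                            ≤⟨ n≤c ⟩
        c                            ≤⟨ m≤n*m c 5 ⟩
        5 * c                        ∎

    module MainCase (c : ℕ) (c≥1 : 1 ≤ c) (8X≤c³ : 8 * X ≤ cube c) (c≤n : c ≤ n) where

      -- X_f ranges over subsets chosen with probability c / n.
      d : ℕ
      d = n ∸ c

      c+d≡n : c + d ≡ n
      c+d≡n = m+[n∸m]≡n c≤n

      open RandomSubsets L c d using (U; B; chosen; hits; hits-sound)

      n² c² : ℕ
      n² = n * n
      c² = c * c

      instance
        c²≢0 : NonZero c²
        c²≢0 = >-nonZero (*-mono-≤ c≥1 c≥1)

      -- k ≈ n²/c²: then 2 Uᵏ ≤ Bᵏ, i.e. (1 − c²/n²)ᵏ ≤ 1/2.
      k : ℕ
      k = suc (n² / c²)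

      n²≤kc² : n² ≤ k * c²
      n²≤kc² = begin
        n²                       ≡⟨ m≡m%n+[m/n]*n n² c² ⟩
        n² % c² + n² / c² * c²   ≤⟨ +-monoˡ-≤ (n² / c² * c²) (<⇒≤ (m%n<n n² c²)) ⟩
        c² + n² / c² * c²        ∎

      kc²≤2n² : k * c² ≤ 2 * n²
      kc²≤2n² = begin
        c² + n² / c² * c²  ≤⟨ +-mono-≤ (*-mono-≤ c≤n c≤n) (m/n*n≤m n² c²) ⟩
        n² + n²            ≡⟨ cong (n² +_) (sym (+-identityʳ n²)) ⟩
        2 * n²             ∎

      -- Popularity threshold R = (3 + log₂ n) k, so that (1 − c²/n²)ᴿ ≤ 2^-(3 + log₂ n) ≤ 1/(4n).
      e R : ℕ
      e = 3 + ⌊log₂ n ⌋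
      R = e * k

      rare : 4 * n * U ^ R ≤ B ^ R
      rare = ≤-trans (*-monoˡ-≤ (U ^ R) 4n≤2^e) (halving-iterate U B k e (halving U c² B k U+c²≡B (subst (_≤ k * c²) (sym B≡n²) n²≤kc²) B≥1))
        where
        B≡n² : B ≡ n²
        B≡n² = cong₂ _*_ c+d≡n c+d≡n
        U+c²≡B : U + c² ≡ B
        U+c²≡B = solve 2 (λ c d → d :* c :+ (c :+ d) :* d :+ c :* c := (c :+ d) :* (c :+ d)) refl c d
        B≥1 : 1 ≤ B
        B≥1 = subst (1 ≤_) (sym B≡n²) (*-mono-≤ n≥1 n≥1)
        4n≤2^e : 4 * n ≤ 2 ^ e
        4n≤2^e = begin
          4 * n                      ≤⟨ *-monoʳ-≤ 4 (<⇒≤ (n<2^[1+log₂n] n n≥1)) ⟩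
          4 * (2 * 2 ^ ⌊log₂ n ⌋)    ≡⟨ solve 1 (λ p → con 4 :* (con 2 :* p) := con 2 :* (con 2 :* (con 2 :* p))) refl (2 ^ ⌊log₂ n ⌋) ⟩
          2 ^ e                      ∎

      a* : Fin n
      a* = proj₁ (quietRow R n≥1)

      unpopular≤c : unpopularInRow R a* ≤ c
      unpopular≤c = *-cancelˡ-≤ c² (*-cancelˡ-≤ n {{>-nonZero n≥1}} (begin
        n * (c² * u)            ≡⟨ solve 3 (λ n c u → n :* (c :* u) := c :* (n :* u)) refl n c² u ⟩
        c² * (n * u)            ≤⟨ *-monoʳ-≤ c² (proj₂ (quietRow R n≥1)) ⟩
        c² * (s * (e * k))      ≡⟨ solve 4 (λ c s e k → c :* (s :* (e :* k)) := s :* e :* (k :* c)) refl c² s e k ⟩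
        s * e * (k * c²)        ≤⟨ *-mono-≤ (*-monoʳ-≤ s e≤4log) kc²≤2n² ⟩
        s * (4 * ⌊log₂ n ⌋) * (2 * n²)
          ≡⟨ solve 3 (λ s L n → s :* (con 4 :* L) :* (con 2 :* (n :* n)) := n :* (con 8 :* (n :* s :* L))) refl s ⌊log₂ n ⌋ n ⟩
        n * (8 * X)             ≤⟨ *-monoʳ-≤ n 8X≤c³ ⟩
        n * cube c              ∎))
        where
        u = unpopularInRow R a*
        e≤4log : e ≤ 4 * ⌊log₂ n ⌋
        e≤4log = begin
          3 + ⌊log₂ n ⌋                ≤⟨ +-monoˡ-≤ ⌊log₂ n ⌋ (*-monoʳ-≤ 3 (⌊log₂⌋-mono-≤ n≥2)) ⟩
          3 * ⌊log₂ n ⌋ + ⌊log₂ n ⌋    ≡⟨ solve 1 (λ L → con 3 :* L :+ L := con 4 :* L) refl ⌊log₂ n ⌋ ⟩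
          4 * ⌊log₂ n ⌋                ∎

      open GoodPair L c d c≥1 c+d≡n R rare a* using (goodPair; size)

      coverFrom : ∀ f g → size f + size g < 4 * c → (∀ i → popular R (κ a* i) ≡ true → hits (κ a* i) f g ≡ true) →
        cube c ≤ 64 * X → Cover L
      coverFrom f g small allHit c³≤64X = a* , A₀′ , A₁ , costWithinBound c (∣ A₀′ ∣ + ∣ ∁ A₁ ∣) cost≤5c c³≤64X , covers
        where
        inA₀′ : Fin n → Bool
        inA₀′ j = chosen f j ∨ chosen g j
        A₀′ A₁ : Subset n
        A₀′ = ⟦ inA₀′ ⟧
        A₁ = ⟦ popular R ∘ κ a* ⟧

        cost≤5c : ∣ A₀′ ∣ + ∣ ∁ A₁ ∣ ≤ 5 * c
        cost≤5c = begin
          ∣ A₀′ ∣ + ∣ ∁ A₁ ∣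
            ≡⟨ cong₂ _+_ (∣⟦⟧∣ inA₀′) (∣∁⟦⟧∣ (popular R ∘ κ a*)) ⟩
          count inA₀′ + count (not ∘ popular R ∘ κ a*)
            ≤⟨ +-mono-≤ (count-∨ (chosen f) (chosen g)) (notPopularInRow R a*) ⟩
          size f + size g + (1 + unpopularInRow R a*)
            ≡⟨ +-suc (size f + size g) _ ⟩
          suc (size f + size g) + unpopularInRow R a*
            ≤⟨ +-mono-≤ small unpopular≤c ⟩
          4 * c + c
            ≡⟨ solve 1 (λ c → con 4 :* c :+ c := con 5 :* c) refl c ⟩
          5 * c ∎

        covers : ∀ i → i ∈ A₁ → PairIn A₀′ (SameLabel L a* i)
        covers i i∈A₁ with popular-sound R (κ a* i) (∈⟦⟧⁻ (popular R ∘ κ a*) i i∈A₁)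
        ... | κ≢0 , _ with hits-sound (κ a* i) f g (allHit i (∈⟦⟧⁻ (popular R ∘ κ a*) i i∈A₁))
        ... | j , l , jChosen , lChosen , κjl≡ =
          j , l , ∈⟦⟧ inA₀′ j (∨-introˡ (chosen g j) jChosen) , ∈⟦⟧ inA₀′ l (∨-introʳ (chosen f l) lChosen) , κjl≡ , κ≢0

      cover : cube c ≤ 64 * X → Cover L
      cover = coverFrom f g small allHit
        where
        f = proj₁ goodPair
        g = proj₁ (proj₂ goodPair)
        small = proj₁ (proj₂ (proj₂ goodPair))
        allHit = proj₂ (proj₂ (proj₂ goodPair))

    -- Choose the scale c ≈ (8X)^(1/3); the main case applies when c ≤ n.
    covering : Cover L
    covering with cubeRoot (8 * X) 8X≥1
      where
      8X≥1 : 1 ≤ 8 * X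
      8X≥1 = ≤-trans (*-mono-≤ (*-mono-≤ n≥1 s≥1) (⌊log₂⌋-mono-≤ n≥2)) (m≤n*m X 8)
    ... | c , c≥1 , 8X≤c³ , c³≤8·8X =
      let c³≤64X = subst (cube c ≤_) (sym (*-assoc 8 8 X)) c³≤8·8X
      in [ (λ c≤n → MainCase.cover c c≥1 8X≤c³ c≤n c³≤64X) , (λ n≤c → emptyCover c n≤c c³≤64X) ]′ (≤-total c n)

-- Cancellation in the additive group
-- makes the labelling injective in rows and columns.
module FromModule {r ℓr m ℓm : Level} {R : CommutativeRing r ℓr} (M : Module R m ℓm) where

  open import Data.Nat
  open import Data.Nat.Properties
  open import Data.Fin using (Fin; toℕ)
  import Data.Fin.Properties as FinP
  open import Data.List using (List; length; lookup)
  open import Data.List.Relation.Unary.Any using (index)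
  open import Data.List.Relation.Unary.Any.Properties using (lookup-index)
  open import Data.Product using (Σ; _,_; _×_; proj₂)
  open import Data.Sum using (_⊎_; inj₁; inj₂)
  open import Data.Empty using (⊥-elim)
  open import Relation.Nullary using (yes; no)
  open import Relation.Binary.PropositionalEquality
  import Algebra.Properties.Group as GroupProperties
  open Module M
  open InModule M
  open GroupProperties +ᴹ-group using (∙-cancelˡ; ∙-cancelʳ; ⁻¹-injective)
  open Covering using (CoverWith; CoverWith-map; SameLabel; covering)

  samePosition : ∀ {L : List Carrierᴹ} {x y} (p : x ∈ᴹ L) (q : y ∈ᴹ L) → toℕ (index p) ≡ toℕ (index q) → x ≈ᴹ y
  samePosition {L} p q e =
    ≈ᴹ-trans (lookup-index p) (≈ᴹ-trans (≈ᴹ-reflexive (cong (lookup L) (FinP.toℕ-injective e))) (≈ᴹ-sym (lookup-index q)))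

  module Sums {k : ℕ} (A : FinSubset k) (L : List Carrierᴹ)
    (mem : ∀ (i j : Fin k) → ¬ (i ≡ j) → (elem A i +ᴹ elem A j) ∈ᴹ L) where

    κ : Fin k → Fin k → ℕ
    κ j l with j FinP.≟ l
    ... | yes _ = 0
    ... | no j≢l = suc (toℕ (index (mem j l j≢l)))

    κ-cases : ∀ j l → (κ j l ≡ 0 × j ≡ l) ⊎ Σ (¬ j ≡ l) λ j≢l → κ j l ≡ suc (toℕ (index (mem j l j≢l)))
    κ-cases j l with j FinP.≟ l
    ... | yes j≡l = inj₁ (refl , j≡l)
    ... | no j≢l = inj₂ (j≢l , refl)

    κ≤ : ∀ j l → κ j l ≤ length L
    κ≤ j l with j FinP.≟ l
    ... | yes _ = z≤n
    ... | no j≢l = FinP.toℕ<n (index (mem j l j≢l))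

    sameLabel : ∀ j l j′ l′ → κ j l ≡ κ j′ l′ → ¬ κ j l ≡ 0 →
      ¬ j′ ≡ l′ × (elem A j +ᴹ elem A l) ≈ᴹ (elem A j′ +ᴹ elem A l′)
    sameLabel j l j′ l′ e κ≢0 with κ-cases j l | κ-cases j′ l′
    ... | inj₁ (κ≡0 , _) | _ = ⊥-elim (κ≢0 κ≡0)
    ... | inj₂ _ | inj₁ (κ′≡0 , _) = ⊥-elim (κ≢0 (trans e κ′≡0))
    ... | inj₂ (j≢l , κ≡) | inj₂ (j′≢l′ , κ′≡) =
      j′≢l′ , samePosition (mem j l j≢l) (mem j′ l′ j′≢l′) (suc-injective (trans (sym κ≡) (trans e κ′≡)))

    labelling : ∀ {k₂} → length L ≤ k₂ → Labelling k k₂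
    labelling len≤ = record
      { κ = κ
      ; κ≤S = λ j l → ≤-trans (κ≤ j l) len≤
      ; rowInjective = λ j l l′ e κ≢0 →
          inj A l l′ (∙-cancelˡ (elem A j) (elem A l) (elem A l′) (proj₂ (sameLabel j l j l′ e κ≢0)))
      ; columnInjective = λ j j′ l e κ≢0 →
          inj A j j′ (∙-cancelʳ (elem A l) (elem A j) (elem A j′) (proj₂ (sameLabel j l j′ l e κ≢0)))
      ; unlabelledOnce = λ a i i′ κ≡0 κ′≡0 → trans (sym (diagonal a i κ≡0)) (diagonal a i′ κ′≡0)
      }
      where
      diagonal : ∀ a i → κ a i ≡ 0 → a ≡ i
      diagonal a i κ≡0 with κ-cases a i
      ... | inj₁ (_ , a≡i) = a≡i
      ... | inj₂ (_ , κ≡) with trans (sym κ≡) κ≡0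
      ... | ()

    restrictedSumCover : ∀ {k₂} → 2 ≤ k → 1 ≤ k₂ → length L ≤ k₂ →
      CoverWith k k₂ (λ a i j l → ¬ (j ≡ l) × (elem A a +ᴹ elem A i) ≈ᴹ (elem A j +ᴹ elem A l))
    restrictedSumCover k≥2 k₂≥1 len≤ = CoverWith-map sameSum (covering k≥2 k₂≥1 (labelling len≤))
      where
      sameSum : ∀ {a i j l} → SameLabel (labelling len≤) a i j l → ¬ (j ≡ l) × (elem A a +ᴹ elem A i) ≈ᴹ (elem A j +ᴹ elem A l)
      sameSum {a} {i} {j} {l} (κ≡ , κ≢0) = sameLabel a i j l (sym κ≡) κ≢0

  module Differences {k : ℕ} (A : FinSubset k) (L : List Carrierᴹ)
    (mem : ∀ (i j : Fin k) → (elem A i -ᴹ elem A j) ∈ᴹ L) where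

    κ : Fin k → Fin k → ℕ
    κ j l = suc (toℕ (index (mem j l)))

    sameLabel : ∀ j l j′ l′ → κ j l ≡ κ j′ l′ → (elem A j -ᴹ elem A l) ≈ᴹ (elem A j′ -ᴹ elem A l′)
    sameLabel j l j′ l′ e = samePosition (mem j l) (mem j′ l′) (suc-injective e)

    labelling : Labelling k (length L)
    labelling = record
      { κ = κ
      ; κ≤S = λ j l → FinP.toℕ<n (index (mem j l))
      ; rowInjective = λ j l l′ e _ →
          inj A l l′ (⁻¹-injective (∙-cancelˡ (elem A j) (-ᴹ elem A l) (-ᴹ elem A l′) (sameLabel j l j l′ e)))
      ; columnInjective = λ j j′ l e _ →
          inj A j j′ (∙-cancelʳ (-ᴹ elem A l) (elem A j) (elem A j′) (sameLabel j l j′ l e))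
      ; unlabelledOnce = λ a i i′ ()
      }

    differenceCover : 2 ≤ k → 1 ≤ length L →
      CoverWith k (length L) (λ a i j l → (elem A a -ᴹ elem A i) ≈ᴹ (elem A j -ᴹ elem A l))
    differenceCover k≥2 L≥1 = CoverWith-map sameDifference (covering k≥2 L≥1 labelling)
      where
      sameDifference : ∀ {a i j l} → SameLabel labelling a i j l → (elem A a -ᴹ elem A i) ≈ᴹ (elem A j -ᴹ elem A l)
      sameDifference {a} {i} {j} {l} (κ≡ , _) = sameLabel a i j l (sym κ≡)

-- Lemma 8 with K = 20, for modules over any commutative ring, in particular
-- over ℚ and ℤ/mℤ.
lemma8 : ∃PosConst λ K →
  ∀ {ℓ ℓ′ : Level} (F : Coeff) (M : Module (ringOf F) ℓ ℓ′) →
  let open Module M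
      open InModule M
  in (C : List Carrierᴹ) (k₁ k₂ : ℕ) → 2 ≤ k₁ → 1 ≤ k₂ →
    ((A : FinSubset k₁) → A ⊆ᴸ C → CardRestrSumLe A k₂ →
      Σ (Fin k₁) λ a* → Σ (Subset k₁) λ A₀′ → Σ (Subset k₁) λ A₁ →
        WithinBound K k₁ k₂ (∣ A₀′ ∣ + ∣ ∁ A₁ ∣) ×
        (∀ i → i ∈ A₁ → Σ (Fin k₁) λ j → Σ (Fin k₁) λ l →
          j ∈ A₀′ × l ∈ A₀′ × ¬ (j ≡ l) ×
          (elem A a* +ᴹ elem A i) ≈ᴹ (elem A j +ᴹ elem A l)))
    ×
    ((A : FinSubset k₁) → A ⊆ᴸ C → CardDiffEq A k₂ →
      Σ (Fin k₁) λ a* → Σ (Subset k₁) λ A₀′ → Σ (Subset k₁) λ A₁ →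
        WithinBound K k₁ k₂ (∣ A₀′ ∣ + ∣ ∁ A₁ ∣) ×
        (∀ i → i ∈ A₁ → Σ (Fin k₁) λ j → Σ (Fin k₁) λ l →
          j ∈ A₀′ × l ∈ A₀′ ×
          (elem A a* -ᴹ elem A i) ≈ᴹ (elem A j -ᴹ elem A l)))
lemma8 = record { const = 20 ; pos = s≤s z≤n ; holds = λ F M C k₁ k₂ k₁≥2 k₂≥1 →
    (λ { A _ (L , len≤ , mem) → FromModule.Sums.restrictedSumCover M A L mem k₁≥2 k₂≥1 len≤ })
  , (λ { A _ (L , _ , refl , mem , _) → FromModule.Differences.differenceCover M A L mem k₁≥2 k₂≥1 }) }
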